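{- If $p$ and $q$ are distinct odd primes, then $pq\notin L_2$, i.e., $\varphi(pq)\nmid (pq-1)^2$.
   Context: $\varphi$ is Euler's totient function. $L_2=\{n\in\mathbb{N} : \varphi(n)\mid (n-1)^2\}$. -}

module Defs where

open import Data.Nat using (ℕ; zero; suc; _+_)
open import Data.Nat.GCD using (gcd)
open import Data.Nat.Properties using (_≟_)
open import Data.List using (List; length; filter)
open import Data.List using (upTo)
open import Data.List using (map)
open import Relation.Nullary.Decidable using (Dec)

φ : ℕ → ℕ
φ n = length (filter (λ k → gcd k n ≟ 1) (map suc (upTo n)))

module Submission where

open import Defs
open import Data.Nat using (ℕ; _*_; _∸_; _^_; _%_)
open import Data.Nat.Divisibility using (_∣_)
open import Data.Nat.Primality using (Prime)
open import Relation.Binary.PropositionalEquality using (_≡_; _≢_)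
open import Relation.Nullary using (¬_)

-- For distinct primes p, q the totient is φ(pq) = (p − 1)(q − 1), and
-- pq − 1 = xy + (x + y) with x = p − 1, y = q − 1.  Hence
--   (pq − 1)² ≡ (x + y)² ≡ x² + y²   (mod xy),
-- so φ(pq) ∣ (pq − 1)² gives xy ∣ x² + y².  Dividing x and y by their gcd
-- leaves coprime a, b with ab ∣ a² + b²; then a ∣ b², so a ∣ b and a = 1,
-- and likewise b = 1, i.e. x = y and p = q.

open import Data.Nat using (zero; suc; _+_; _≤_; NonZero; NonTrivial; ≢-nonZero; ≢-nonZero⁻¹; z≤n; s≤s)
open import Data.Nat.Base using (nonTrivial⇒≢1)
open import Data.Nat.Properties
open import Data.Nat.Divisibility
  using (divides; _∣?_; ∣-refl; ∣-trans; m∣m*n; n∣m*n; ∣m+n∣m⇒∣n; ∣⇒≤; m*n∣⇒m∣; m*n∣⇒n∣; *-cancelˡ-∣)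
open import Data.Nat.DivMod using (_/_; m/n*n≡m)
open import Data.Nat.GCD using (gcd; gcd[m,n]∣m; gcd[m,n]∣n; gcd[m,n]≢0)
open import Data.Nat.Coprimality using (Coprime; coprime-divisor; coprime-/gcd; gcd≡1⇒coprime; coprime⇒gcd≡1)
import Data.Nat.Coprimality as Coprime
open import Data.Nat.Primality using (prime⇒irreducible; prime⇒nonTrivial; prime⇒nonZero)
open import Data.Nat.Tactic.RingSolver using (solve-∀)
open import Algebra.Properties.CommutativeSemigroup +-commutativeSemigroup using (interchange)
open import Data.List using (length; filter; applyUpTo; _++_; [_])
open import Data.List.Properties using (map-upTo; applyUpTo-∷ʳ; filter-++; length-++)
open import Data.Product using (_×_; _,_; proj₁; proj₂)
open import Data.Sum using (_⊎_; inj₁; inj₂)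
open import Data.Bool using (true; false)
open import Function using (_∘_)
open import Relation.Nullary using (Dec; _because_; yes; no; ¬?; contradiction)
open import Relation.Nullary.Decidable using (_×-dec_; _⊎-dec_)
open import Relation.Unary using (Decidable)
open import Relation.Binary.PropositionalEquality using (refl; sym; trans; cong; cong₂; subst; subst₂; module ≡-Reasoning)
open ≡-Reasoning

ind : {P : Set} → Dec P → ℕ
ind (true because _) = 1
ind (false because _) = 0

count : {P : ℕ → Set} → Decidable P → ℕ → ℕ
count P? zero = 0
count P? (suc n) = count P? n + ind (P? (suc n))

length-filter-1…n : {P : ℕ → Set} (P? : Decidable P) (n : ℕ) →
  length (filter P? (applyUpTo suc n)) ≡ count P? n
length-filter-1…n P? zero = refl
length-filter-1…n P? (suc n) = begin
    length (filter P? (applyUpTo suc (suc n)))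
  ≡⟨ cong (length ∘ filter P?) (sym (applyUpTo-∷ʳ suc n)) ⟩
    length (filter P? (applyUpTo suc n ++ [ suc n ]))
  ≡⟨ cong length (filter-++ P? (applyUpTo suc n) [ suc n ]) ⟩
    length (filter P? (applyUpTo suc n) ++ filter P? [ suc n ])
  ≡⟨ length-++ (filter P? (applyUpTo suc n)) ⟩
    length (filter P? (applyUpTo suc n)) + length (filter P? [ suc n ])
  ≡⟨ cong₂ _+_ (length-filter-1…n P? n) (length-filter-singleton (suc n)) ⟩
    count P? (suc n) ∎
  where
  length-filter-singleton : ∀ x → length (filter P? [ x ]) ≡ ind (P? x)
  length-filter-singleton x with P? x
  ... | true because _ = refl
  ... | false because _ = refl

φ≡count : ∀ n → φ n ≡ count (λ k → gcd k n ≟ 1) n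
φ≡count n = trans (cong (length ∘ filter (λ k → gcd k n ≟ 1)) (map-upTo suc n))
                  (length-filter-1…n (λ k → gcd k n ≟ 1) n)

count-cong : {P Q : ℕ → Set} (P? : Decidable P) (Q? : Decidable Q) →
  (∀ k → P k → Q k) → (∀ k → Q k → P k) → ∀ n → count P? n ≡ count Q? n
count-cong P? Q? P⇒Q Q⇒P zero = refl
count-cong {P} {Q} P? Q? P⇒Q Q⇒P (suc n) =
  cong₂ _+_ (count-cong P? Q? P⇒Q Q⇒P n) (ind-cong (P? (suc n)) (Q? (suc n)))
  where
  ind-cong : (p : Dec (P (suc n))) (q : Dec (Q (suc n))) → ind p ≡ ind q
  ind-cong (yes _) (yes _) = refl
  ind-cong (no _) (no _) = refl
  ind-cong (yes p) (no ¬q) = contradiction (P⇒Q (suc n) p) ¬q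
  ind-cong (no ¬p) (yes q) = contradiction (Q⇒P (suc n) q) ¬p

count-additive : {P Q R S : ℕ → Set}
  (P? : Decidable P) (Q? : Decidable Q) (R? : Decidable R) (S? : Decidable S) →
  (∀ k → ind (P? k) + ind (Q? k) ≡ ind (R? k) + ind (S? k)) →
  ∀ n → count P? n + count Q? n ≡ count R? n + count S? n
count-additive P? Q? R? S? pointwise zero = refl
count-additive P? Q? R? S? pointwise (suc n) = begin
    (count P? n + ind (P? (suc n))) + (count Q? n + ind (Q? (suc n)))
  ≡⟨ interchange (count P? n) _ _ _ ⟩
    (count P? n + count Q? n) + (ind (P? (suc n)) + ind (Q? (suc n)))
  ≡⟨ cong₂ _+_ (count-additive P? Q? R? S? pointwise n) (pointwise (suc n)) ⟩
    (count R? n + count S? n) + (ind (R? (suc n)) + ind (S? (suc n)))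
  ≡⟨ interchange (count R? n) _ _ _ ⟩
    (count R? n + ind (R? (suc n))) + (count S? n + ind (S? (suc n))) ∎

count-complement : {P : ℕ → Set} (P? : Decidable P) →
  ∀ n → count P? n + count (¬? ∘ P?) n ≡ n
count-complement P? zero = refl
count-complement P? (suc n) = begin
    (count P? n + ind (P? (suc n))) + (count (¬? ∘ P?) n + ind (¬? (P? (suc n))))
  ≡⟨ interchange (count P? n) _ _ _ ⟩
    (count P? n + count (¬? ∘ P?) n) + (ind (P? (suc n)) + ind (¬? (P? (suc n))))
  ≡⟨ cong₂ _+_ (count-complement P? n) (exactly-one (P? (suc n))) ⟩
    n + 1
  ≡⟨ +-comm n 1 ⟩
    suc n ∎
  where
  exactly-one : {A : Set} (a? : Dec A) → ind a? + ind (¬? a?) ≡ 1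
  exactly-one (true because _) = refl
  exactly-one (false because _) = refl

count-inclusion-exclusion : {A B : ℕ → Set} (A? : Decidable A) (B? : Decidable B) →
  ∀ n → count A? n + count B? n ≡ count (λ k → A? k ⊎-dec B? k) n + count (λ k → A? k ×-dec B? k) n
count-inclusion-exclusion A? B? = count-additive A? B? _ _ pointwise
  where
  pointwise : ∀ k → ind (A? k) + ind (B? k) ≡ ind (A? k ⊎-dec B? k) + ind (A? k ×-dec B? k)
  pointwise k with A? k | B? k
  ... | true because _ | true because _ = refl
  ... | true because _ | false because _ = refl
  ... | false because _ | true because _ = refl
  ... | false because _ | false because _ = refl

count-multiples-+ : ∀ e m r → r ≤ e → count (suc e ∣?_) (m * suc e + r) ≡ m
count-multiples-+ e zero zero _ = refl
count-multiples-+ e (suc m) zero _ = begin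
    count (d ∣?_) (suc m * d + 0)
  ≡⟨ cong (count (d ∣?_)) (trans (+-identityʳ _) (cong suc (+-comm e (m * d)))) ⟩
    count (d ∣?_) (m * d + e) + ind (d ∣? suc (m * d + e))
  ≡⟨ cong₂ _+_ (count-multiples-+ e m e ≤-refl) (multiple (d ∣? suc (m * d + e))) ⟩
    m + 1
  ≡⟨ +-comm m 1 ⟩
    suc m ∎
  where
  d : ℕ
  d = suc e
  multiple : (d∣? : Dec (d ∣ suc (m * d + e))) → ind d∣? ≡ 1
  multiple (yes _) = refl
  multiple (no d∤) = contradiction (divides (suc m) (cong suc (+-comm (m * d) e))) d∤
count-multiples-+ e m (suc r) r<e = begin
    count (d ∣?_) (m * d + suc r)
  ≡⟨ cong (count (d ∣?_)) (+-suc (m * d) r) ⟩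
    count (d ∣?_) (m * d + r) + ind (d ∣? suc (m * d + r))
  ≡⟨ cong₂ _+_ (count-multiples-+ e m r (<⇒≤ r<e)) (non-multiple (d ∣? suc (m * d + r))) ⟩
    m + 0
  ≡⟨ +-identityʳ m ⟩
    m ∎
  where
  d : ℕ
  d = suc e
  -- m·d + (r + 1) lies strictly between two consecutive multiples of d.
  non-multiple : (d∣? : Dec (d ∣ suc (m * d + r))) → ind d∣? ≡ 0
  non-multiple (no _) = refl
  non-multiple (yes d∣) = contradiction (∣⇒≤ (∣m+n∣m⇒∣n (subst (d ∣_) (sym (+-suc (m * d) r)) d∣) (n∣m*n m)))
                                        (<⇒≱ (s≤s r<e))

count-multiples : ∀ d .{{_ : NonZero d}} m → count (d ∣?_) (m * d) ≡ m
count-multiples (suc e) m =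
  trans (cong (count (suc e ∣?_)) (sym (+-identityʳ (m * suc e)))) (count-multiples-+ e m 0 z≤n)

coprime-* : ∀ {k m n} → Coprime k m → Coprime k n → Coprime k (m * n)
coprime-* {k} {m} k⊥m k⊥n {d} (d∣k , d∣mn) = k⊥n (d∣k , coprime-divisor d⊥m d∣mn)
  where
  d⊥m : Coprime d m
  d⊥m (e∣d , e∣m) = k⊥m (∣-trans e∣d d∣k , e∣m)

coprime⇒*∣ : ∀ {m n k} → Coprime m n → m ∣ k → n ∣ k → m * n ∣ k
coprime⇒*∣ {m} {n} {k} m⊥n (divides c k≡cm) n∣k with coprime-divisor (Coprime.sym m⊥n) n∣mc
  where
  n∣mc : n ∣ m * c
  n∣mc = subst (n ∣_) (trans k≡cm (*-comm c m)) n∣k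
... | divides e c≡en = divides e (begin
    k           ≡⟨ k≡cm ⟩
    c * m       ≡⟨ cong (_* m) c≡en ⟩
    e * n * m   ≡⟨ *-assoc e n m ⟩
    e * (n * m) ≡⟨ cong (e *_) (*-comm n m) ⟩
    e * (m * n) ∎)

prime⇒≢1 : ∀ {p} → Prime p → p ≢ 1
prime⇒≢1 p-prime = nonTrivial⇒≢1 {{prime⇒nonTrivial p-prime}}

prime∤⇒coprime : ∀ {p k} → Prime p → ¬ p ∣ k → Coprime k p
prime∤⇒coprime p-prime p∤k (d∣k , d∣p) with prime⇒irreducible p-prime d∣p
... | inj₁ d≡1 = d≡1
... | inj₂ refl = contradiction d∣k p∤k

distinct-primes⇒coprime : ∀ {p q} → Prime p → Prime q → p ≢ q → Coprime p q
distinct-primes⇒coprime {p} {q} p-prime q-prime p≢q = prime∤⇒coprime q-prime q∤p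
  where
  q∤p : ¬ q ∣ p
  q∤p q∣p with prime⇒irreducible p-prime q∣p
  ... | inj₁ q≡1 = prime⇒≢1 q-prime q≡1
  ... | inj₂ q≡p = p≢q (sym q≡p)

coprime-pq⇔ : ∀ {p q} → Prime p → Prime q → ∀ k →
  (gcd k (p * q) ≡ 1 → ¬ (p ∣ k ⊎ q ∣ k)) × (¬ (p ∣ k ⊎ q ∣ k) → gcd k (p * q) ≡ 1)
coprime-pq⇔ {p} {q} p-prime q-prime k = to , from
  where
  to : gcd k (p * q) ≡ 1 → ¬ (p ∣ k ⊎ q ∣ k)
  to gcd≡1 (inj₁ p∣k) = prime⇒≢1 p-prime (gcd≡1⇒coprime gcd≡1 (p∣k , m∣m*n q))
  to gcd≡1 (inj₂ q∣k) = prime⇒≢1 q-prime (gcd≡1⇒coprime gcd≡1 (q∣k , n∣m*n p))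
  from : ¬ (p ∣ k ⊎ q ∣ k) → gcd k (p * q) ≡ 1
  from p∤k∧q∤k = coprime⇒gcd≡1 (coprime-* (prime∤⇒coprime p-prime (p∤k∧q∤k ∘ inj₁))
                                          (prime∤⇒coprime q-prime (p∤k∧q∤k ∘ inj₂)))

-- Inclusion–exclusion over 1, …, pq, stated without subtraction:
-- φ(pq) = pq − (multiples of p) − (multiples of q) + (multiples of pq).
φ[pq]+p+q : ∀ {p q} → Prime p → Prime q → p ≢ q → φ (p * q) + (p + q) ≡ p * q + 1
φ[pq]+p+q {p} {q} p-prime q-prime p≢q = begin
    φ n + (p + q)
  ≡⟨ cong₂ _+_ φ-coprimes (+-comm p q) ⟩
    count neither? n + (q + p)
  ≡⟨ cong (count neither? n +_) (sym (cong₂ _+_ multiples-of-p multiples-of-q)) ⟩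
    count neither? n + (count (p ∣?_) n + count (q ∣?_) n)
  ≡⟨ cong (count neither? n +_) (count-inclusion-exclusion (p ∣?_) (q ∣?_) n) ⟩
    count neither? n + (count either? n + count both? n)
  ≡⟨ cong (λ b → count neither? n + (count either? n + b)) multiples-of-pq ⟩
    count neither? n + (count either? n + 1)
  ≡⟨ sym (+-assoc (count neither? n) _ 1) ⟩
    count neither? n + count either? n + 1
  ≡⟨ cong (_+ 1) (trans (+-comm (count neither? n) _) (count-complement either? n)) ⟩
    n + 1 ∎
  where
  n : ℕ
  n = p * q
  instance
    p≢0 : NonZero p
    p≢0 = prime⇒nonZero p-prime
    q≢0 : NonZero q
    q≢0 = prime⇒nonZero q-prime
    n≢0 : NonZero n
    n≢0 = m*n≢0 p q
  either? : Decidable (λ k → p ∣ k ⊎ q ∣ k)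
  either? k = p ∣? k ⊎-dec q ∣? k
  both? : Decidable (λ k → p ∣ k × q ∣ k)
  both? k = p ∣? k ×-dec q ∣? k
  neither? : Decidable (λ k → ¬ (p ∣ k ⊎ q ∣ k))
  neither? k = ¬? (either? k)
  φ-coprimes : φ n ≡ count neither? n
  φ-coprimes = trans (φ≡count n) (count-cong _ neither?
    (λ k → proj₁ (coprime-pq⇔ p-prime q-prime k)) (λ k → proj₂ (coprime-pq⇔ p-prime q-prime k)) n)
  multiples-of-p : count (p ∣?_) n ≡ q
  multiples-of-p = trans (cong (count (p ∣?_)) (*-comm p q)) (count-multiples p q)
  multiples-of-q : count (q ∣?_) n ≡ p
  multiples-of-q = count-multiples q p
  multiples-of-pq : count both? n ≡ 1
  multiples-of-pq = begin
      count both? n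
    ≡⟨ count-cong both? (n ∣?_) (λ k (p∣k , q∣k) → coprime⇒*∣ (distinct-primes⇒coprime p-prime q-prime p≢q) p∣k q∣k)
                                (λ k n∣k → m*n∣⇒m∣ p q n∣k , m*n∣⇒n∣ p q n∣k) n ⟩
      count (n ∣?_) n
    ≡⟨ cong (count (n ∣?_)) (sym (*-identityˡ n)) ⟩
      count (n ∣?_) (1 * n)
    ≡⟨ count-multiples n 1 ⟩
      1 ∎

≡pq+1⇒≡[p-1][q-1] : ∀ a p q → .{{_ : NonZero p}} → .{{_ : NonZero q}} →
  a + (p + q) ≡ p * q + 1 → a ≡ (p ∸ 1) * (q ∸ 1)
≡pq+1⇒≡[p-1][q-1] a (suc x) (suc y) eq = +-cancelʳ-≡ (suc x + suc y) a (x * y) (trans eq (expand x y))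
  where
  expand : ∀ x y → suc x * suc y + 1 ≡ x * y + (suc x + suc y)
  expand = solve-∀

φ[pq] : ∀ {p q} → Prime p → Prime q → p ≢ q → φ (p * q) ≡ (p ∸ 1) * (q ∸ 1)
φ[pq] {p} {q} p-prime q-prime p≢q =
  ≡pq+1⇒≡[p-1][q-1] (φ (p * q)) p q {{prime⇒nonZero p-prime}} {{prime⇒nonZero q-prime}}
    (φ[pq]+p+q p-prime q-prime p≢q)

-- If a, b are coprime and ab ∣ a² + b², then a ∣ b², hence a ∣ b, hence a = 1.
coprime∧*∣sumOfSquares⇒≡1 : ∀ {a b} → Coprime a b → a * b ∣ a * a + b * b → a ≡ 1
coprime∧*∣sumOfSquares⇒≡1 {a} {b} a⊥b ab∣ = a⊥b (∣-refl , coprime-divisor a⊥b a∣b*b)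
  where
  a∣b*b : a ∣ b * b
  a∣b*b = ∣m+n∣m⇒∣n (∣-trans (m∣m*n b) ab∣) (m∣m*n a)

-- For x > 0, xy ∣ x² + y² forces x = y: write x = ag, y = bg with g = gcd x y
-- and a, b coprime; then ab ∣ a² + b², so a = b = 1.
*∣sumOfSquares⇒≡ : ∀ x y → .{{_ : NonZero x}} → x * y ∣ x * x + y * y → x ≡ y
*∣sumOfSquares⇒≡ x y xy∣ = begin
    x      ≡⟨ x≡ag ⟩
    a * g  ≡⟨ cong (_* g) (trans a≡1 (sym b≡1)) ⟩
    b * g  ≡⟨ sym y≡bg ⟩
    y      ∎
  where
  g : ℕ
  g = gcd x y
  instance
    g≢0 : NonZero g
    g≢0 = ≢-nonZero (gcd[m,n]≢0 x y (inj₁ (≢-nonZero⁻¹ x)))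
    gg≢0 : NonZero (g * g)
    gg≢0 = m*n≢0 g g
  a b : ℕ
  a = x / g
  b = y / g
  x≡ag : x ≡ a * g
  x≡ag = sym (m/n*n≡m (gcd[m,n]∣m x y))
  y≡bg : y ≡ b * g
  y≡bg = sym (m/n*n≡m (gcd[m,n]∣n x y))
  a⊥b : Coprime a b
  a⊥b = coprime-/gcd x y
  scale-product : ∀ a b g → a * g * (b * g) ≡ g * g * (a * b)
  scale-product = solve-∀
  scale-squares : ∀ a b g → a * g * (a * g) + b * g * (b * g) ≡ g * g * (a * a + b * b)
  scale-squares = solve-∀
  ab∣ : a * b ∣ a * a + b * b
  ab∣ = *-cancelˡ-∣ (g * g) (subst₂ _∣_
          (trans (cong₂ _*_ x≡ag y≡bg) (scale-product a b g))
          (trans (cong₂ _+_ (cong₂ _*_ x≡ag x≡ag) (cong₂ _*_ y≡bg y≡bg)) (scale-squares a b g))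
          xy∣)
  a≡1 : a ≡ 1
  a≡1 = coprime∧*∣sumOfSquares⇒≡1 a⊥b ab∣
  b≡1 : b ≡ 1
  b≡1 = coprime∧*∣sumOfSquares⇒≡1 (Coprime.sym a⊥b) (subst₂ _∣_ (*-comm a b) (+-comm (a * a) (b * b)) ab∣)

-- With x = p − 1, y = q − 1 we have pq − 1 = xy + (x + y), so
-- (pq − 1)² = xy (xy + 2(x + y) + 2) + (x² + y²), and xy ∣ (pq − 1)² means
-- xy ∣ x² + y².
[p-1][q-1]∣[pq-1]²⇒≡ : ∀ p q → .{{_ : NonTrivial p}} → .{{_ : NonTrivial q}} →
  (p ∸ 1) * (q ∸ 1) ∣ (p * q ∸ 1) ^ 2 → p ≡ q
[p-1][q-1]∣[pq-1]²⇒≡ (suc (suc x′)) (suc (suc y′)) xy∣ =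
  cong suc (*∣sumOfSquares⇒≡ x y (∣m+n∣m⇒∣n (subst (x * y ∣_) (square-expansion x y) xy∣)
                                             (m∣m*n (x * y + 2 * (x + y) + 2))))
  where
  x y : ℕ
  x = suc x′
  y = suc y′
  -- suc x * suc y ∸ 1 reduces to y + x * (1 + y), and s ^ 2 to s * (s * 1).
  square-expansion : ∀ m n → (n + m * (1 + n)) * ((n + m * (1 + n)) * 1)
                           ≡ m * n * (m * n + 2 * (m + n) + 2) + (m * m + n * n)
  square-expansion = solve-∀

mainTheorem3 : (p q : ℕ) → Prime p → Prime q → p % 2 ≡ 1 → q % 2 ≡ 1 → p ≢ q →
    ¬ (φ (p * q) ∣ (p * q ∸ 1) ^ 2)
mainTheorem3 p q p-prime q-prime _ _ p≢q φ[pq]∣ =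
  p≢q ([p-1][q-1]∣[pq-1]²⇒≡ p q {{prime⇒nonTrivial p-prime}} {{prime⇒nonTrivial q-prime}}
         (subst (_∣ (p * q ∸ 1) ^ 2) (φ[pq] p-prime q-prime p≢q) φ[pq]∣))
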